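{- Let $p$ be a prime and $u,\ell\in\mathbb{N}$. For all integer partitions $\lambda=1^{m_1}2^{m_2}\cdots\ell^{m_\ell}$, $$\sum_{\mu\subseteq\lambda}C_{\lambda,\mu}(p)p^{ -u|\mu|}=O_{p,\ell}\big(p^{(\lambda'|\lambda')/2}\big),$$ where the implied constant depends only on $p$ and $\ell$.
   Context: A partition $\lambda=1^{m_1}\cdots\ell^{m_\ell}$ has $m_i$ parts equal to $i$; $|\mu|$ is the sum of the parts of $\mu$; the conjugate $\lambda'$ has $\lambda'_k=\sum_{j\geq k}m_j$; $(\lambda'|\lambda')=\sum_i(\lambda'_i)^2$; $\mu\subseteq\lambda$ means $\mu_i\leq\lambda_i$ for all $i$, and the sum ranges over all such partitions $\mu$. With $(q;q)_n=\prod_{i=1}^n(1-q^i)$ and $\binom{n}{k}_q=\frac{(q;q)_n}{(q;q)_k(q;q)_{n-k}}$, $C_{\lambda,\mu}(p)=p^{\sum_{i\geq1}\mu'_{i+1}(\lambda'_i-\mu'_i)}\prod_{i\geq1}\binom{\lambda'_i-\mu'_{i+1}}{\lambda'_i-\mu'_i}_{p}$. -}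

module Defs where

open import Data.Nat as ℕ using (ℕ; zero; suc; _+_; _*_; _∸_; _^_; _≤ᵇ_)
open import Data.Bool using (Bool; true; false; _∧_; if_then_else_)
open import Data.List as List using (List; []; _∷_; _++_; replicate; concatMap; upTo; drop)
open import Data.Vec as Vec using (Vec)
open import Data.Integer using (+_)
open import Data.Rational as ℚ using (ℚ; 0ℚ; 1ℚ; _/_; ≢-nonZero)
open import Data.Rational.Properties using (_≟_)
open import Relation.Nullary using (yes; no)

toℚ : ℕ → ℚ
toℚ n = + n / 1

-- total division on ℚ (x / 0 := 0); only ever used with nonzero denominators here
_÷'_ : ℚ → ℚ → ℚ
x ÷' y with y ≟ 0ℚ
... | yes _ = 0ℚ
... | no y≢0 = ℚ._÷_ x y {{≢-nonZero y≢0}}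

sumℕ : List ℕ → ℕ
sumℕ = List.foldr _+_ 0

sumℚ : List ℚ → ℚ
sumℚ = List.foldr ℚ._+_ 0ℚ

prodℚ : List ℚ → ℚ
prodℚ = List.foldr ℚ._*_ 1ℚ

qPoch : ℕ → ℕ → ℚ
qPoch p zero    = 1ℚ
qPoch p (suc n) = qPoch p n ℚ.* (1ℚ ℚ.- toℚ (p ^ suc n))

qBinom : ℕ → ℕ → ℕ → ℚ
qBinom p n k = if k ≤ᵇ n then qPoch p n ÷' (qPoch p k ℚ.* qPoch p (n ∸ k)) else 0ℚ

-- A partition with parts ≤ ℓ is encoded by its multiplicity vector
-- m = (m_1, …, m_ℓ) : Vec ℕ ℓ  (m_j = number of parts equal to j).

-- the parts of the partition, in weakly decreasing order
partsAux : ℕ → List ℕ → List ℕ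
partsAux j []       = []
partsAux j (x ∷ xs) = partsAux (suc j) xs ++ replicate x j

parts : ∀ {ℓ} → Vec ℕ ℓ → List ℕ
parts m = partsAux 1 (Vec.toList m)

size : ∀ {ℓ} → Vec ℕ ℓ → ℕ
size m = sumℕ (parts m)

-- conjugate: λ'_k = Σ_{j ≥ k} m_j   (k ≥ 1; λ'_k = 0 for k > ℓ)
conj : ∀ {ℓ} → Vec ℕ ℓ → ℕ → ℕ
conj m k = sumℕ (drop (k ∸ 1) (Vec.toList m))

normSq : ∀ {ℓ} → Vec ℕ ℓ → ℕ
normSq {ℓ} m = sumℕ (List.map (λ j → conj m (suc j) ^ 2) (upTo ℓ))

-- μ ⊆ λ on lists of parts: μ_i ≤ λ_i for all i (missing parts are 0)
leqParts : List ℕ → List ℕ → Bool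
leqParts []       _        = true
leqParts (x ∷ xs) []       = x ≤ᵇ 0
leqParts (x ∷ xs) (y ∷ ys) = (x ≤ᵇ y) ∧ leqParts xs ys

_⊆ᵇ_ : ∀ {ℓ} → Vec ℕ ℓ → Vec ℕ ℓ → Bool
μ ⊆ᵇ λ′ = leqParts (parts μ) (parts λ′)

allVecs : (ℓ B : ℕ) → List (Vec ℕ ℓ)
allVecs zero    B = Vec.[] ∷ []
allVecs (suc ℓ) B = concatMap (λ x → List.map (x Vec.∷_) (allVecs ℓ B)) (upTo (suc B))

boolFilter : ∀ {A : Set} → (A → Bool) → List A → List A
boolFilter P [] = []
boolFilter P (x ∷ xs) = if P x then x ∷ boolFilter P xs else boolFilter P xs

-- all partitions μ ⊆ λ (each listed exactly once; any μ ⊆ λ has parts ≤ ℓ and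
-- multiplicities ≤ number of parts of λ ≤ Σ_j m_j)
subPartitions : ∀ {ℓ} → Vec ℕ ℓ → List (Vec ℕ ℓ)
subPartitions {ℓ} λ′ = boolFilter (λ μ → μ ⊆ᵇ λ′) (allVecs ℓ (sumℕ (Vec.toList λ′)))

-- C_{λ,μ}(p) = p^{Σ_i μ'_{i+1}(λ'_i - μ'_i)} ∏_i [λ'_i - μ'_{i+1} choose λ'_i - μ'_i]_p
-- (factors with i > ℓ are trivial)
C : ∀ {ℓ} → ℕ → Vec ℕ ℓ → Vec ℕ ℓ → ℚ
C {ℓ} p λ′ μ =
  toℚ (p ^ sumℕ (List.map (λ j → conj μ (suc (suc j)) * (conj λ′ (suc j) ∸ conj μ (suc j))) (upTo ℓ)))
  ℚ.* prodℚ (List.map (λ j → qBinom p (conj λ′ (suc j) ∸ conj μ (suc (suc j)))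
                                      (conj λ′ (suc j) ∸ conj μ (suc j))) (upTo ℓ))

S : ∀ {ℓ} → ℕ → ℕ → Vec ℕ ℓ → ℚ
S p u λ′ = sumℚ (List.map (λ μ → C p λ′ μ ÷' toℚ (p ^ (u * size μ))) (subPartitions λ′))

module Submission where

-- For such p every Gaussian binomial
-- [n choose k]_p is a natural number, at most p^(n + k(n-k)), because it obeys
-- the q-Pascal recursion; hence every coefficient C_{λ,μ}(p) is a natural
-- number.  Write A = λ'_1 (the number of parts of λ) and N = (λ'|λ').  For the
-- i-th factor of C_{λ,μ}(p), with a = λ'_i, b = μ'_i ≥ b' = μ'_{i+1}, the
-- exponents add up to at most A + (a-b)b, and 4(a-b)b ≤ a², so
--     C_{λ,μ}(p) ≤ p^(ℓA + ⌊N/4⌋).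
-- Dividing by p^(u|μ|) ≥ 1 only shrinks a summand, and there are at most
-- (A+1)^ℓ ≤ p^(ℓA) partitions μ ⊆ λ, so  0 ≤ S ≤ p^(2ℓA + ⌊N/4⌋).  Finally
-- A² ≤ N and 8ℓA ≤ A² + 16ℓ² give  S² ≤ p^(8ℓ²) p^N,  i.e. the theorem with
-- K = p^(8ℓ²) (uniformly in u).

open import Defs
open import Data.Nat using (ℕ; _^_)
open import Data.Nat.Primality using (Prime)
open import Data.Vec using (Vec)
open import Data.Product using (∃-syntax)

module Bounds where

  open import Data.Nat as ℕ using (zero; suc; _+_; _*_; _∸_; _≤ᵇ_; _≤_; z≤n; s≤s; NonZero)
  open import Data.Nat.Properties
  open import Data.Nat.DivMod using (_/_; m*n/n≡m; /-monoˡ-≤; m/n*n≤m)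
  open import Data.Nat.Tactic.RingSolver using (solve-∀)
  open import Data.Nat.Primality using (prime⇒nonTrivial)
  open import Data.Nat.Coprimality as Coprime using (1-coprimeTo)
  open import Data.Integer as ℤ using (+_)
  import Data.Integer.Properties as ℤP
  open import Data.Rational as ℚ using (ℚ; mkℚ; 0ℚ; 1ℚ; 1/_)
  import Data.Rational.Properties as ℚP
  open import Data.Rational.Solver using (module +-*-Solver)
  open import Data.List as List using (List; []; _∷_; drop; upTo; length)
  open import Data.Nat.ListAction using (product)
  import Data.List.Properties as ListP
  import Data.Vec as Vec
  open import Data.Bool using (Bool; true; false; if_then_else_; T)
  open import Data.Product using (_×_; _,_; proj₁; proj₂)
  open import Data.Sum using (inj₁; inj₂)
  open import Data.Empty using (⊥-elim)
  open import Relation.Nullary using (yes; no)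
  open import Relation.Binary.PropositionalEquality

  -- The embedding ℕ → ℚ.  toℚ n is already in normal form, which makes it a
  -- semiring homomorphism that preserves and reflects order.

  toℚ-normal : ∀ n → toℚ n ≡ mkℚ (+ n) 0 (Coprime.sym (1-coprimeTo n))
  toℚ-normal n = ℚP.normalize-coprime (Coprime.sym (1-coprimeTo n))

  toℚ-+ : ∀ m n → toℚ (m + n) ≡ toℚ m ℚ.+ toℚ n
  toℚ-+ m n rewrite toℚ-normal m | toℚ-normal n =
    ℚP./-cong {+ (m + n)} {1} {+ m ℤ.* + 1 ℤ.+ + n ℤ.* + 1} {1}
      (trans (ℤP.pos-+ m n) (sym (cong₂ ℤ._+_ (ℤP.*-identityʳ (+ m)) (ℤP.*-identityʳ (+ n))))) refl

  toℚ-* : ∀ m n → toℚ (m * n) ≡ toℚ m ℚ.* toℚ n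
  toℚ-* m n rewrite toℚ-normal m | toℚ-normal n =
    ℚP./-cong {+ (m * n)} {1} {+ m ℤ.* + n} {1} (ℤP.pos-* m n) refl

  toℚ-mono : ∀ {m n} → m ≤ n → toℚ m ℚ.≤ toℚ n
  toℚ-mono {m} {n} m≤n rewrite toℚ-normal m | toℚ-normal n =
    ℚ.*≤* (subst₂ ℤ._≤_ (sym (ℤP.*-identityʳ (+ m))) (sym (ℤP.*-identityʳ (+ n)))
                        (ℤ.+≤+ m≤n))

  toℚ-injective : ∀ {m n} → toℚ m ≡ toℚ n → m ≡ n
  toℚ-injective {m} {n} eq rewrite toℚ-normal m | toℚ-normal n = ℤP.+-injective (cong ℚ.↥_ eq)

  toℚ-nonNeg : ∀ n → 0ℚ ℚ.≤ toℚ n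
  toℚ-nonNeg n = toℚ-mono (z≤n {n})

  *-nonzero : ∀ x y → x ≢ 0ℚ → y ≢ 0ℚ → x ℚ.* y ≢ 0ℚ
  *-nonzero x y x≢0 y≢0 xy≡0 = x≢0 (begin
      x                    ≡⟨ sym (ℚP.*-identityʳ x) ⟩
      x ℚ.* 1ℚ             ≡⟨ cong (x ℚ.*_) (sym (ℚP.*-inverseʳ y)) ⟩
      x ℚ.* (y ℚ.* 1/ y)   ≡⟨ sym (ℚP.*-assoc x y (1/ y)) ⟩
      (x ℚ.* y) ℚ.* 1/ y   ≡⟨ cong (ℚ._* 1/ y) xy≡0 ⟩
      0ℚ ℚ.* 1/ y          ≡⟨ ℚP.*-zeroˡ (1/ y) ⟩
      0ℚ                   ∎)
    where
    open ≡-Reasoning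
    instance
      y-nonZero : ℚ.NonZero y
      y-nonZero = ℚ.≢-nonZero y≢0

  ÷'-exact : ∀ x y z → x ≡ z ℚ.* y → y ≢ 0ℚ → x ÷' y ≡ z
  ÷'-exact x y z x≡zy y≢0 with y ℚP.≟ 0ℚ
  ... | yes y≡0 = ⊥-elim (y≢0 y≡0)
  ... | no y≢0′ = begin
      x ℚ.* 1/ y             ≡⟨ cong (ℚ._* 1/ y) x≡zy ⟩
      z ℚ.* y ℚ.* 1/ y       ≡⟨ ℚP.*-assoc z y (1/ y) ⟩
      z ℚ.* (y ℚ.* 1/ y)     ≡⟨ cong (z ℚ.*_) (ℚP.*-inverseʳ y) ⟩
      z ℚ.* 1ℚ               ≡⟨ ℚP.*-identityʳ z ⟩
      z                      ∎
    where
    open ≡-Reasoning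
    instance
      y-nonZero : ℚ.NonZero y
      y-nonZero = ℚ.≢-nonZero y≢0′

  ÷'-shrinks : ∀ x y → 0ℚ ℚ.≤ x → 1ℚ ℚ.≤ y → 0ℚ ℚ.≤ x ÷' y × x ÷' y ℚ.≤ x
  ÷'-shrinks x y 0≤x 1≤y with y ℚP.≟ 0ℚ
  ... | yes _ = ℚP.≤-refl , 0≤x
  ... | no _ = 0≤x/y , x/y≤x
    where
    instance
      y-positive : ℚ.Positive y
      y-positive = ℚ.positive (ℚP.<-≤-trans (ℚ.*<* (ℤ.+<+ (s≤s z≤n))) 1≤y)
      y-nonZero : ℚ.NonZero y
      y-nonZero = ℚP.pos⇒nonZero y
      1/y-nonNeg : ℚ.NonNegative (1/ y)
      1/y-nonNeg = ℚP.pos⇒nonNeg (1/ y) {{ℚP.1/pos⇒pos y}}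
      x-nonNeg : ℚ.NonNegative x
      x-nonNeg = ℚ.nonNegative 0≤x
    0≤x/y : 0ℚ ℚ.≤ x ℚ.* 1/ y
    0≤x/y = ℚP.nonNegative⁻¹ _ {{ℚP.nonNeg*nonNeg⇒nonNeg x (1/ y)}}
    x/y*y≡x : x ℚ.* 1/ y ℚ.* y ≡ x
    x/y*y≡x = trans (ℚP.*-assoc x (1/ y) y)
                    (trans (cong (x ℚ.*_) (ℚP.*-inverseˡ y)) (ℚP.*-identityʳ x))
    x/y≤x : x ℚ.* 1/ y ℚ.≤ x
    x/y≤x = ℚP.≤-trans (ℚP.≤-reflexive (sym (ℚP.*-identityʳ _)))
              (subst (x ℚ.* 1/ y ℚ.* 1ℚ ℚ.≤_) x/y*y≡x
                (ℚP.*-monoˡ-≤-nonNeg (x ℚ.* 1/ y) {{ℚ.nonNegative 0≤x/y}} 1≤y))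

  square-bound : ∀ Q K M {x} → 0ℚ ℚ.≤ x → x ℚ.≤ toℚ Q → Q * Q ≤ K * M →
                 x ℚ.* x ℚ.≤ toℚ K ℚ.* toℚ M
  square-bound Q K M {x} 0≤x x≤Q Q²≤KM =
    ℚP.≤-trans (ℚP.*-monoʳ-≤-nonNeg x {{ℚ.nonNegative 0≤x}} x≤Q)
      (ℚP.≤-trans (ℚP.*-monoˡ-≤-nonNeg (toℚ Q) {{ℚ.nonNegative (toℚ-nonNeg Q)}} x≤Q)
        (subst₂ ℚ._≤_ (toℚ-* Q Q) (toℚ-* K M) (toℚ-mono Q²≤KM)))

  2≤⇒nonZero : ∀ {p} → 2 ≤ p → NonZero p
  2≤⇒nonZero 2≤p = ℕ.>-nonZero (≤-trans (s≤s z≤n) 2≤p)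

  -- Gaussian binomials at q = p.  gauss p a b = [a+b choose a]_p, defined by
  -- the q-Pascal recursion, so it is visibly a natural number.

  gauss : ℕ → ℕ → ℕ → ℕ
  gauss p zero    b       = 1
  gauss p (suc a) zero    = 1
  gauss p (suc a) (suc b) = gauss p a (suc b) + p ^ suc a * gauss p (suc a) b

  -- In the inductive step, with
  -- X = p^(a+1), Y = p^(b+1) and R = (p;p)_(a+b+1), the two q-Pascal terms
  -- contribute (1-X)R and X(1-Y)R, which sum to (1-XY)R = (p;p)_(a+b+2).
  gauss-qPoch : ∀ p a b → toℚ (gauss p a b) ℚ.* (qPoch p a ℚ.* qPoch p b) ≡ qPoch p (a + b)
  gauss-qPoch p zero b = trans (ℚP.*-identityˡ _) (ℚP.*-identityˡ _)
  gauss-qPoch p (suc a) zero =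
    trans (ℚP.*-identityˡ _) (trans (ℚP.*-identityʳ _) (cong (qPoch p) (sym (+-identityʳ (suc a)))))
  gauss-qPoch p (suc a) (suc b) = begin
      toℚ (gauss p a (suc b) + p ^ suc a * gauss p (suc a) b) ℚ.* (qPoch p (suc a) ℚ.* qPoch p (suc b))
        ≡⟨ cong (ℚ._* (qPoch p (suc a) ℚ.* qPoch p (suc b)))
                (trans (toℚ-+ (gauss p a (suc b)) _)
                       (cong (G₁ ℚ.+_) (toℚ-* (p ^ suc a) (gauss p (suc a) b)))) ⟩
      (G₁ ℚ.+ X ℚ.* G₂) ℚ.* ((Pa ℚ.* (1ℚ ℚ.- X)) ℚ.* (Pb ℚ.* (1ℚ ℚ.- Y)))
        ≡⟨ solve 6 (λ G₁ G₂ X Y Pa Pb →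
                      (G₁ :+ X :* G₂) :* ((Pa :* (con 1ℚ :- X)) :* (Pb :* (con 1ℚ :- Y)))
                   := (con 1ℚ :- X) :* (G₁ :* (Pa :* (Pb :* (con 1ℚ :- Y))))
                      :+ X :* (con 1ℚ :- Y) :* (G₂ :* ((Pa :* (con 1ℚ :- X)) :* Pb)))
                 refl G₁ G₂ X Y Pa Pb ⟩
      (1ℚ ℚ.- X) ℚ.* (G₁ ℚ.* (Pa ℚ.* (Pb ℚ.* (1ℚ ℚ.- Y))))
        ℚ.+ X ℚ.* (1ℚ ℚ.- Y) ℚ.* (G₂ ℚ.* ((Pa ℚ.* (1ℚ ℚ.- X)) ℚ.* Pb))
        ≡⟨ cong₂ (λ u v → (1ℚ ℚ.- X) ℚ.* u ℚ.+ X ℚ.* (1ℚ ℚ.- Y) ℚ.* v)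
                 (gauss-qPoch p a (suc b))
                 (trans (gauss-qPoch p (suc a) b) (cong (qPoch p) (sym (+-suc a b)))) ⟩
      (1ℚ ℚ.- X) ℚ.* R ℚ.+ X ℚ.* (1ℚ ℚ.- Y) ℚ.* R
        ≡⟨ solve 3 (λ X Y R → (con 1ℚ :- X) :* R :+ X :* (con 1ℚ :- Y) :* R
                             := R :* (con 1ℚ :- X :* Y)) refl X Y R ⟩
      R ℚ.* (1ℚ ℚ.- X ℚ.* Y)
        ≡⟨ cong (λ z → R ℚ.* (1ℚ ℚ.- z))
                (trans (sym (toℚ-* (p ^ suc a) (p ^ suc b)))
                       (cong toℚ (sym (^-distribˡ-+-* p (suc a) (suc b))))) ⟩
      qPoch p (suc a + suc b) ∎
    where
    open ≡-Reasoning
    open +-*-Solver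
    G₁ G₂ X Y Pa Pb R : ℚ
    G₁ = toℚ (gauss p a (suc b))
    G₂ = toℚ (gauss p (suc a) b)
    X = toℚ (p ^ suc a)
    Y = toℚ (p ^ suc b)
    Pa = qPoch p a
    Pb = qPoch p b
    R = qPoch p (a + suc b)

  qPoch-nonzero : ∀ p n → 2 ≤ p → qPoch p n ≢ 0ℚ
  qPoch-nonzero p zero    _   ()
  qPoch-nonzero p (suc n) 2≤p = *-nonzero _ _ (qPoch-nonzero p n 2≤p) one-minus-power≢0
    where
    instance
      p-nonZero : NonZero p
      p-nonZero = 2≤⇒nonZero 2≤p
    power≢1 : p ^ suc n ≢ 1
    power≢1 eq = <⇒≢ (≤-trans 2≤p (m≤m*n p (p ^ n) {{m^n≢0 p n}})) (sym eq)
    one-minus-power≢0 : 1ℚ ℚ.- toℚ (p ^ suc n) ≢ 0ℚ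
    one-minus-power≢0 eq = power≢1 (toℚ-injective (begin
        toℚ (p ^ suc n)                    ≡⟨ solve 1 (λ X → X := con 1ℚ :- (con 1ℚ :- X)) refl _ ⟩
        1ℚ ℚ.- (1ℚ ℚ.- toℚ (p ^ suc n))    ≡⟨ cong (λ z → 1ℚ ℚ.- z) eq ⟩
        1ℚ                                 ∎))
      where
      open ≡-Reasoning
      open +-*-Solver

  -- [n choose k]_p as a natural number (zero when k > n); it agrees with the
  -- rational qBinom of Defs because (p;p)_k (p;p)_(n-k) ≠ 0.
  gaussBinom : ℕ → ℕ → ℕ → ℕ
  gaussBinom p n k = if k ≤ᵇ n then gauss p k (n ∸ k) else 0

  qBinom-natural : ∀ p n k → 2 ≤ p → qBinom p n k ≡ toℚ (gaussBinom p n k)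
  qBinom-natural p n k 2≤p with k ≤ᵇ n in k≤ᵇn
  ... | false = refl
  ... | true  = ÷'-exact _ _ _
                  (trans (cong (qPoch p) (sym (m+[n∸m]≡n k≤n))) (sym (gauss-qPoch p k (n ∸ k))))
                  (*-nonzero _ _ (qPoch-nonzero p k 2≤p) (qPoch-nonzero p (n ∸ k) 2≤p))
    where
    k≤n : k ≤ n
    k≤n = ≤ᵇ⇒≤ k n (subst T (sym k≤ᵇn) _)

  -- Size of Gaussian binomials: [a+b choose a]_p ≤ p^(a + b + ab), by
  -- induction along q-Pascal, using 2 ≤ p to absorb the doubling.
  gauss-bound : ∀ p a b → 2 ≤ p → gauss p a b ≤ p ^ (a + b + a * b)
  gauss-bound p zero    b       2≤p = m^n>0 p {{2≤⇒nonZero 2≤p}} (b + 0)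
  gauss-bound p (suc a) zero    2≤p = m^n>0 p {{2≤⇒nonZero 2≤p}} (suc a + 0 + suc a * 0)
  gauss-bound p (suc a) (suc b) 2≤p = begin
      gauss p a (suc b) + p ^ suc a * gauss p (suc a) b
        ≤⟨ +-mono-≤ (≤-trans (gauss-bound p a (suc b) 2≤p) (^-monoʳ-≤ p left-exponent))
                    (≤-trans (*-monoʳ-≤ (p ^ suc a) (gauss-bound p (suc a) b 2≤p))
                             (≤-reflexive (trans (sym (^-distribˡ-+-* p (suc a) _))
                                                 (cong (p ^_) (right-exponent a b))))) ⟩
      p ^ E + p ^ E
        ≡⟨ cong (λ z → p ^ E + z) (sym (+-identityʳ (p ^ E))) ⟩
      2 * p ^ E
        ≤⟨ *-monoˡ-≤ (p ^ E) 2≤p ⟩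
      p * p ^ E ∎
    where
    open ≤-Reasoning
    instance
      p-nonZero : NonZero p
      p-nonZero = 2≤⇒nonZero 2≤p
    E : ℕ
    E = a + suc b + suc a * suc b
    left-exponent : a + suc b + a * suc b ≤ E
    left-exponent = +-monoʳ-≤ (a + suc b) (*-monoˡ-≤ (suc b) (n≤1+n a))
    right-exponent : ∀ a b → suc a + (suc a + b + suc a * b) ≡ a + suc b + suc a * suc b
    right-exponent = solve-∀

  gaussBinom-bound : ∀ p n k → 2 ≤ p → gaussBinom p n k ≤ p ^ (n + k * (n ∸ k))
  gaussBinom-bound p n k 2≤p with k ≤ᵇ n in k≤ᵇn
  ... | false = z≤n
  ... | true  = subst (λ e → gauss p k (n ∸ k) ≤ p ^ (e + k * (n ∸ k)))
                      (m+[n∸m]≡n k≤n) (gauss-bound p k (n ∸ k) 2≤p)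
    where
    k≤n : k ≤ n
    k≤n = ≤ᵇ⇒≤ k n (subst T (sym k≤ᵇn) _)

  two-mul≤sum-squares : ∀ x y → 2 * (x * y) ≤ x * x + y * y
  two-mul≤sum-squares x y with ≤-total x y
  ... | inj₁ x≤y with m≤n⇒∃[o]m+o≡n x≤y
  ...   | d , refl = ≤-trans (m≤m+n _ (d * d)) (≤-reflexive (identity x d))
    where
    identity : ∀ x d → 2 * (x * (x + d)) + d * d ≡ x * x + (x + d) * (x + d)
    identity = solve-∀
  two-mul≤sum-squares x y | inj₂ y≤x with m≤n⇒∃[o]m+o≡n y≤x
  ...   | d , refl = ≤-trans (m≤m+n _ (d * d)) (≤-reflexive (identity y d))
    where
    identity : ∀ y d → 2 * ((y + d) * y) + d * d ≡ (y + d) * (y + d) + y * y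
    identity = solve-∀

  four-product≤square : ∀ a b → 4 * ((a ∸ b) * b) ≤ a ^ 2
  four-product≤square a b with ≤-total b a
  ... | inj₂ a≤b rewrite m≤n⇒m∸n≡0 a≤b = z≤n
  ... | inj₁ b≤a with m≤n⇒∃[o]m+o≡n b≤a
  ...   | x , refl rewrite m+n∸m≡n b x = begin
      4 * (x * b)                       ≡⟨ double x b ⟩
      2 * (x * b) + 2 * (x * b)         ≤⟨ +-monoʳ-≤ (2 * (x * b)) (two-mul≤sum-squares x b) ⟩
      2 * (x * b) + (x * x + b * b)     ≡⟨ square x b ⟩
      (b + x) ^ 2                       ∎
    where
    open ≤-Reasoning
    double : ∀ x b → 4 * (x * b) ≡ 2 * (x * b) + 2 * (x * b)
    double = solve-∀
    square : ∀ x b → 2 * (x * b) + (x * x + b * b) ≡ (b + x) * ((b + x) * 1)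
    square = solve-∀

  shifted-exponent : ∀ a b b' → b' ≤ b →
                     b' * (a ∸ b) + (a ∸ b) * ((a ∸ b') ∸ (a ∸ b)) ≤ (a ∸ b) * b
  shifted-exponent a b b' b'≤b with ≤-total b a
  ... | inj₂ a≤b rewrite m≤n⇒m∸n≡0 a≤b | *-zeroʳ b' = z≤n
  ... | inj₁ b≤a with m≤n⇒∃[o]m+o≡n b'≤b | m≤n⇒∃[o]m+o≡n b≤a
  ...   | d , refl | x , refl
    rewrite m+n∸m≡n (b' + d) x | +-assoc b' d x | m+n∸m≡n b' (d + x) | m+n∸n≡m d x =
    ≤-reflexive (factor b' d x)
    where
    factor : ∀ b' d x → b' * x + x * d ≡ x * (b' + d)
    factor = solve-∀

  -- Exponent of one factor of C_{λ,μ}(p): the p-power b'(a-b) plus the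
  -- size bound of [a-b' choose a-b]_p is at most A + (a-b)b when a ≤ A.
  factor-exponent : ∀ A a b b' → a ≤ A → b' ≤ b →
                    b' * (a ∸ b) + ((a ∸ b') + (a ∸ b) * ((a ∸ b') ∸ (a ∸ b))) ≤ A + (a ∸ b) * b
  factor-exponent A a b b' a≤A b'≤b = begin
      b' * (a ∸ b) + ((a ∸ b') + (a ∸ b) * ((a ∸ b') ∸ (a ∸ b)))
        ≡⟨ swap (b' * (a ∸ b)) (a ∸ b') _ ⟩
      (a ∸ b') + (b' * (a ∸ b) + (a ∸ b) * ((a ∸ b') ∸ (a ∸ b)))
        ≤⟨ +-mono-≤ (≤-trans (m∸n≤m a b') a≤A) (shifted-exponent a b b' b'≤b) ⟩
      A + (a ∸ b) * b ∎
    where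
    open ≤-Reasoning
    swap : ∀ u v w → u + (v + w) ≡ v + (u + w)
    swap = solve-∀

  suc≤power : ∀ p n → 2 ≤ p → suc n ≤ p ^ n
  suc≤power p zero    2≤p = ≤-refl
  suc≤power p (suc n) 2≤p = begin
      suc (suc n)     ≤⟨ +-monoˡ-≤ (suc n) (s≤s (z≤n {n})) ⟩
      suc n + suc n   ≡⟨ cong (λ z → suc n + z) (sym (+-identityʳ (suc n))) ⟩
      2 * suc n       ≤⟨ *-mono-≤ 2≤p (suc≤power p n 2≤p) ⟩
      p * p ^ n       ∎
    where open ≤-Reasoning

  ≤-quarter : ∀ {H N} → 4 * H ≤ N → H ≤ N / 4
  ≤-quarter {H} {N} 4H≤N =
    ≤-trans (≤-reflexive (sym (m*n/n≡m H 4)))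
            (/-monoˡ-≤ 4 (≤-trans (≤-reflexive (*-comm H 4)) 4H≤N))

  exponent-budget : ∀ ℓ A N → A * A ≤ N →
                    (ℓ * A + (ℓ * A + N / 4)) + (ℓ * A + (ℓ * A + N / 4)) ≤ 8 * (ℓ * ℓ) + N
  exponent-budget ℓ A N A²≤N = *-cancelˡ-≤ 2 (begin
      2 * ((ℓ * A + (ℓ * A + F)) + (ℓ * A + (ℓ * A + F)))
        ≡⟨ regroup ℓ A F ⟩
      2 * (A * (4 * ℓ)) + F * 4
        ≤⟨ +-mono-≤ (two-mul≤sum-squares A (4 * ℓ)) (m/n*n≤m N 4) ⟩
      A * A + 4 * ℓ * (4 * ℓ) + N
        ≤⟨ +-monoˡ-≤ N (+-monoˡ-≤ (4 * ℓ * (4 * ℓ)) A²≤N) ⟩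
      N + 4 * ℓ * (4 * ℓ) + N
        ≡⟨ collect N ℓ ⟩
      2 * (8 * (ℓ * ℓ) + N) ∎)
    where
    open ≤-Reasoning
    F : ℕ
    F = N / 4
    regroup : ∀ ℓ A F → 2 * ((ℓ * A + (ℓ * A + F)) + (ℓ * A + (ℓ * A + F)))
                        ≡ 2 * (A * (4 * ℓ)) + F * 4
    regroup = solve-∀
    collect : ∀ N ℓ → N + 4 * ℓ * (4 * ℓ) + N ≡ 2 * (8 * (ℓ * ℓ) + N)
    collect = solve-∀

  module _ {X : Set} where

    sum-mono : ∀ (f g : X → ℕ) xs → (∀ x → f x ≤ g x) →
               sumℕ (List.map f xs) ≤ sumℕ (List.map g xs)
    sum-mono f g []       f≤g = z≤n
    sum-mono f g (x ∷ xs) f≤g = +-mono-≤ (f≤g x) (sum-mono f g xs f≤g)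

    sum-+ : ∀ (f g : X → ℕ) xs →
            sumℕ (List.map (λ x → f x + g x) xs) ≡ sumℕ (List.map f xs) + sumℕ (List.map g xs)
    sum-+ f g []       = refl
    sum-+ f g (x ∷ xs) rewrite sum-+ f g xs = interchange (f x) (g x) _ _
      where
      interchange : ∀ a b c d → a + b + (c + d) ≡ a + c + (b + d)
      interchange = solve-∀

    sum-*ˡ : ∀ c (f : X → ℕ) xs → sumℕ (List.map (λ x → c * f x) xs) ≡ c * sumℕ (List.map f xs)
    sum-*ˡ c f []       = sym (*-zeroʳ c)
    sum-*ˡ c f (x ∷ xs) rewrite sum-*ˡ c f xs = sym (*-distribˡ-+ c (f x) _)

    sum-const : ∀ c (xs : List X) → sumℕ (List.map (λ _ → c) xs) ≡ length xs * c
    sum-const c []       = refl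
    sum-const c (x ∷ xs) rewrite sum-const c xs = refl

    product-bound : ∀ p (g e : X → ℕ) xs → (∀ x → g x ≤ p ^ e x) →
                    product (List.map g xs) ≤ p ^ sumℕ (List.map e xs)
    product-bound p g e []       g≤ = s≤s z≤n
    product-bound p g e (x ∷ xs) g≤ = ≤-trans (*-mono-≤ (g≤ x) (product-bound p g e xs g≤))
                                              (≤-reflexive (sym (^-distribˡ-+-* p (e x) _)))

    prodℚ-natural : ∀ (f : X → ℚ) (g : X → ℕ) xs → (∀ x → f x ≡ toℚ (g x)) →
                    prodℚ (List.map f xs) ≡ toℚ (product (List.map g xs))
    prodℚ-natural f g []       f≡g = refl
    prodℚ-natural f g (x ∷ xs) f≡g rewrite prodℚ-natural f g xs f≡g | f≡g x = sym (toℚ-* (g x) _)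

    sumℚ-bounds : ∀ (f : X → ℚ) P xs → (∀ x → 0ℚ ℚ.≤ f x × f x ℚ.≤ toℚ P) →
                  0ℚ ℚ.≤ sumℚ (List.map f xs) × sumℚ (List.map f xs) ℚ.≤ toℚ (length xs * P)
    sumℚ-bounds f P []       f∈ = ℚP.≤-refl , ℚP.≤-refl
    sumℚ-bounds f P (x ∷ xs) f∈ =
      ℚP.+-mono-≤ {0ℚ} {f x} {0ℚ} (proj₁ (f∈ x)) (proj₁ rest) ,
      subst (f x ℚ.+ sumℚ (List.map f xs) ℚ.≤_) (sym (toℚ-+ P (length xs * P)))
            (ℚP.+-mono-≤ (proj₂ (f∈ x)) (proj₂ rest))
      where
      rest : 0ℚ ℚ.≤ sumℚ (List.map f xs) × sumℚ (List.map f xs) ℚ.≤ toℚ (length xs * P)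
      rest = sumℚ-bounds f P xs f∈

    boolFilter-length : ∀ (P : X → Bool) xs → length (boolFilter P xs) ≤ length xs
    boolFilter-length P []       = z≤n
    boolFilter-length P (x ∷ xs) with P x
    ... | true  = s≤s (boolFilter-length P xs)
    ... | false = m≤n⇒m≤1+n (boolFilter-length P xs)

  length-concatMap : ∀ {X Y : Set} (f : X → List Y) L xs → (∀ x → length (f x) ≡ L) →
                     length (List.concatMap f xs) ≡ length xs * L
  length-concatMap f L []       lf≡L = refl
  length-concatMap f L (x ∷ xs) lf≡L
    rewrite ListP.length-++ (f x) {List.concatMap f xs} | lf≡L x | length-concatMap f L xs lf≡L = refl

  allVecs-length : ∀ ℓ B → length (allVecs ℓ B) ≡ suc B ^ ℓ
  allVecs-length zero    B = refl
  allVecs-length (suc ℓ) B =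
    trans (length-concatMap (λ x → List.map (x Vec.∷_) (allVecs ℓ B)) (suc B ^ ℓ) (upTo (suc B))
            (λ x → trans (ListP.length-map (x Vec.∷_) (allVecs ℓ B)) (allVecs-length ℓ B)))
          (cong (_* (suc B ^ ℓ)) (ListP.length-upTo (suc B)))

  -- Conjugate partitions.  λ'_k is a tail sum of the multiplicities, so it is
  -- weakly decreasing in k and bounded by λ'_1, and λ'_1² ≤ (λ'|λ').

  tail-sum-antitone : ∀ j xs → sumℕ (drop (suc j) xs) ≤ sumℕ (drop j xs)
  tail-sum-antitone zero    []       = z≤n
  tail-sum-antitone zero    (x ∷ xs) = m≤n+m _ x
  tail-sum-antitone (suc j) []       = z≤n
  tail-sum-antitone (suc j) (x ∷ xs) = tail-sum-antitone j xs

  tail-sum≤sum : ∀ j xs → sumℕ (drop j xs) ≤ sumℕ xs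
  tail-sum≤sum zero    xs       = ≤-refl
  tail-sum≤sum (suc j) []       = z≤n
  tail-sum≤sum (suc j) (x ∷ xs) = ≤-trans (tail-sum≤sum j xs) (m≤n+m _ x)

  conj-antitone : ∀ {ℓ} (m : Vec ℕ ℓ) j → conj m (suc (suc j)) ≤ conj m (suc j)
  conj-antitone m j = tail-sum-antitone j (Vec.toList m)

  conj≤conj₁ : ∀ {ℓ} (m : Vec ℕ ℓ) j → conj m (suc j) ≤ conj m 1
  conj≤conj₁ m j = tail-sum≤sum j (Vec.toList m)

  conj₁²≤normSq : ∀ {ℓ} (m : Vec ℕ ℓ) → conj m 1 * conj m 1 ≤ normSq m
  conj₁²≤normSq {zero}  Vec.[] = z≤n
  conj₁²≤normSq {suc ℓ} m      =
    ≤-trans (≤-reflexive (cong (conj m 1 *_) (sym (*-identityʳ (conj m 1))))) (m≤m+n _ _)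

  budgetConstant : ℕ → ℕ → ℕ
  budgetConstant p ℓ = p ^ (8 * (ℓ * ℓ))

  module Estimates (p : ℕ) (2≤p : 2 ≤ p) {ℓ : ℕ} (m : Vec ℕ ℓ) where

    instance
      p-nonZero : NonZero p
      p-nonZero = 2≤⇒nonZero 2≤p

    λ' : ℕ → ℕ
    λ' j = conj m (suc j)

    numParts : ℕ
    numParts = conj m 1

    norm : ℕ
    norm = normSq m

    -- Every summand of S is at most p^termExp.
    termExp : ℕ
    termExp = ℓ * numParts + norm / 4

    powerExp top bottom binomial binomialExp : Vec ℕ ℓ → ℕ → ℕ
    powerExp    μ j = conj μ (suc (suc j)) * (λ' j ∸ conj μ (suc j))
    top         μ j = λ' j ∸ conj μ (suc (suc j))
    bottom      μ j = λ' j ∸ conj μ (suc j)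
    binomial    μ j = gaussBinom p (top μ j) (bottom μ j)
    binomialExp μ j = top μ j + bottom μ j * (top μ j ∸ bottom μ j)

    Cℕ : Vec ℕ ℓ → ℕ
    Cℕ μ = p ^ sumℕ (List.map (powerExp μ) (upTo ℓ)) * product (List.map (binomial μ) (upTo ℓ))

    C-natural : ∀ μ → C p m μ ≡ toℚ (Cℕ μ)
    C-natural μ =
      trans (cong (toℚ power ℚ.*_)
                  (prodℚ-natural _ (binomial μ) (upTo ℓ)
                    (λ j → qBinom-natural p (top μ j) (bottom μ j) 2≤p)))
            (sym (toℚ-* power (product (List.map (binomial μ) (upTo ℓ)))))
      where power = p ^ sumℕ (List.map (powerExp μ) (upTo ℓ))

    crossTerm : Vec ℕ ℓ → ℕ → ℕ
    crossTerm μ j = (λ' j ∸ conj μ (suc j)) * conj μ (suc j)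

    cross-terms≤quarter : ∀ μ → sumℕ (List.map (crossTerm μ) (upTo ℓ)) ≤ norm / 4
    cross-terms≤quarter μ = ≤-quarter (≤-trans
      (≤-reflexive (sym (sum-*ˡ 4 (crossTerm μ) (upTo ℓ))))
      (sum-mono (λ j → 4 * crossTerm μ j) (λ j → λ' j ^ 2) (upTo ℓ)
                (λ j → four-product≤square (λ' j) (conj μ (suc j)))))

    Cℕ-bound : ∀ μ → Cℕ μ ≤ p ^ termExp
    Cℕ-bound μ = begin
        p ^ Σ (powerExp μ) * product (List.map (binomial μ) js)
          ≤⟨ *-monoʳ-≤ (p ^ Σ (powerExp μ))
               (product-bound p (binomial μ) (binomialExp μ) js
                 (λ j → gaussBinom-bound p (top μ j) (bottom μ j) 2≤p)) ⟩
        p ^ Σ (powerExp μ) * p ^ Σ (binomialExp μ)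
          ≡⟨ sym (^-distribˡ-+-* p (Σ (powerExp μ)) (Σ (binomialExp μ))) ⟩
        p ^ (Σ (powerExp μ) + Σ (binomialExp μ))
          ≡⟨ cong (p ^_) (sym (sum-+ (powerExp μ) (binomialExp μ) js)) ⟩
        p ^ Σ (λ j → powerExp μ j + binomialExp μ j)
          ≤⟨ ^-monoʳ-≤ p (sum-mono _ (λ j → numParts + crossTerm μ j) js (λ j →
               factor-exponent numParts (λ' j) (conj μ (suc j)) (conj μ (suc (suc j)))
                               (conj≤conj₁ m j) (conj-antitone μ j))) ⟩
        p ^ Σ (λ j → numParts + crossTerm μ j)
          ≡⟨ cong (p ^_) (sum-+ (λ _ → numParts) (crossTerm μ) js) ⟩
        p ^ (Σ (λ _ → numParts) + Σ (crossTerm μ))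
          ≡⟨ cong (λ z → p ^ (z + Σ (crossTerm μ)))
                  (trans (sum-const numParts js) (cong (_* numParts) (ListP.length-upTo ℓ))) ⟩
        p ^ (ℓ * numParts + Σ (crossTerm μ))
          ≤⟨ ^-monoʳ-≤ p (+-monoʳ-≤ (ℓ * numParts) (cross-terms≤quarter μ)) ⟩
        p ^ termExp ∎
      where
      open ≤-Reasoning
      js : List ℕ
      js = upTo ℓ
      Σ : (ℕ → ℕ) → ℕ
      Σ f = sumℕ (List.map f js)

    term : ℕ → Vec ℕ ℓ → ℚ
    term u μ = C p m μ ÷' toℚ (p ^ (u * size μ))

    term-bounds : ∀ u μ → 0ℚ ℚ.≤ term u μ × term u μ ℚ.≤ toℚ (p ^ termExp)
    term-bounds u μ =
      proj₁ shrink ,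
      ℚP.≤-trans (proj₂ shrink)
                 (ℚP.≤-trans (ℚP.≤-reflexive (C-natural μ)) (toℚ-mono (Cℕ-bound μ)))
      where
      shrink : 0ℚ ℚ.≤ term u μ × term u μ ℚ.≤ C p m μ
      shrink = ÷'-shrinks (C p m μ) (toℚ (p ^ (u * size μ)))
                 (subst (0ℚ ℚ.≤_) (sym (C-natural μ)) (toℚ-nonNeg (Cℕ μ)))
                 (toℚ-mono (m^n>0 p (u * size μ)))

    count-bound : length (subPartitions m) ≤ suc numParts ^ ℓ
    count-bound = ≤-trans (boolFilter-length _ (allVecs ℓ numParts))
                          (≤-reflexive (allVecs-length ℓ numParts))

    totalBound : ℕ
    totalBound = suc numParts ^ ℓ * p ^ termExp

    S-bounds : ∀ u → 0ℚ ℚ.≤ S p u m × S p u m ℚ.≤ toℚ totalBound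
    S-bounds u =
      proj₁ bounds , ℚP.≤-trans (proj₂ bounds) (toℚ-mono (*-monoˡ-≤ (p ^ termExp) count-bound))
      where
      bounds : 0ℚ ℚ.≤ S p u m × S p u m ℚ.≤ toℚ (length (subPartitions m) * p ^ termExp)
      bounds = sumℚ-bounds (term u) (p ^ termExp) (subPartitions m) (term-bounds u)

    totalBound≤power : totalBound ≤ p ^ (ℓ * numParts + termExp)
    totalBound≤power = begin
        suc numParts ^ ℓ * p ^ termExp
          ≤⟨ *-monoˡ-≤ (p ^ termExp) (^-monoˡ-≤ ℓ (suc≤power p numParts 2≤p)) ⟩
        (p ^ numParts) ^ ℓ * p ^ termExp
          ≡⟨ cong (_* p ^ termExp) (trans (^-*-assoc p numParts ℓ) (cong (p ^_) (*-comm numParts ℓ))) ⟩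
        p ^ (ℓ * numParts) * p ^ termExp
          ≡⟨ sym (^-distribˡ-+-* p (ℓ * numParts) termExp) ⟩
        p ^ (ℓ * numParts + termExp) ∎
      where open ≤-Reasoning

    totalBound²≤budget : totalBound * totalBound ≤ budgetConstant p ℓ * p ^ norm
    totalBound²≤budget = begin
        totalBound * totalBound  ≤⟨ *-mono-≤ totalBound≤power totalBound≤power ⟩
        p ^ e * p ^ e            ≡⟨ sym (^-distribˡ-+-* p e e) ⟩
        p ^ (e + e)              ≤⟨ ^-monoʳ-≤ p (exponent-budget ℓ numParts norm (conj₁²≤normSq m)) ⟩
        p ^ (8 * (ℓ * ℓ) + norm) ≡⟨ ^-distribˡ-+-* p (8 * (ℓ * ℓ)) norm ⟩
        p ^ (8 * (ℓ * ℓ)) * p ^ norm ∎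
      where
      open ≤-Reasoning
      e : ℕ
      e = ℓ * numParts + termExp

  prime⇒2≤ : ∀ {p} → Prime p → 2 ≤ p
  prime⇒2≤ {p} p-prime = ℕ.nonTrivial⇒n>1 p {{prime⇒nonTrivial p-prime}}

open Bounds using (budgetConstant; prime⇒2≤; square-bound; module Estimates)
open import Data.Rational using (_≤_; _*_)
open import Data.Product using (_,_; proj₁; proj₂)

proposition1 : ∀ (p : ℕ) → Prime p → ∀ (ℓ : ℕ) → ∃[ K ] ∀ (u : ℕ) (m : Vec ℕ ℓ) →
    S p u m * S p u m ≤ toℚ K * toℚ (p ^ normSq m)
proposition1 p p-prime ℓ = budgetConstant p ℓ , λ u m →
  let open Estimates p (prime⇒2≤ p-prime) m
  in square-bound totalBound (budgetConstant p ℓ) (p ^ normSq m)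
                  (proj₁ (S-bounds u)) (proj₂ (S-bounds u)) totalBound²≤budget
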